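{- Let $H$; $K_1,\ldots,K_r$ be connected graphs with pairwise disjoint vertex sets $V_H$; $V_1,\ldots,V_r$, carrying weight functions $\alpha:V_H\to[0,\infty)$ and $\beta_i:V_i\to[0,\infty)$, $i=1,\ldots,r$. Put $A=\sum_{u\in V_H}\alpha(u)$, $B_i=\sum_{v\in V_i}\beta_i(v)$, $B=\sum_{i=1}^r B_i$ and $W=A+B$. Let $x_1,\ldots,x_r\in V_H$ and $y_i\in V_i$ ($i=1,\ldots,r$), and let $G=(V,E)$ be the graft product of $H$ with $K_1,\ldots,K_r$ at the pairs $(x_i,y_i)$, so that $|V|=|V_H|+|V_1|+\cdots+|V_r|-r$, with weight function $\gamma=\alpha+\beta_1+\cdots+\beta_r$. Then $$ M_G^{\gamma}=M_{H}^{\alpha}+\sum_{i=1}^r M_{K_i}^{\beta_i}+\sum_{i=1}^r M_H^{\xi_i}(x_i)+\sum_{i=1}^r M_{K_i}^{\eta_i}(y_i)+\sum_{i,j=1}^r(|V_i|-1)\operatorname{dist}_H(x_i,x_j)B_j, $$ where $\xi_i=(|V_i|-1)\alpha+B_i$ (a function on $V_H$) and $\eta_i=(|V|-|V_i|)\beta_i+W-B_i$ (a function on $V_i$), for $i=1,\ldots,r$.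
   Context: For a connected graph $G$ with vertex set $V$, distance function $\operatorname{dist}$, and a function $\rho:V\to\mathbb{R}$ (a weight function; a constant $c$ denotes the constant function $c$), the $\rho$-moment of $G$ at $u\in V$ is $M_G^{\rho}(u)=\sum_{v\in V}\rho(v)\operatorname{dist}(v,u)$, and the $\rho$-moment of $G$ is $M_G^{\rho}=\sum_{u\in V}M_G^{\rho}(u)$. The graft product of $H$ with $K_1,\ldots,K_r$ at the pairs $(x_i,y_i)$ is the graph obtained from the disjoint union of $H,K_1,\ldots,K_r$ by identifying $x_i$ with $y_i$ for every $i=1,\ldots,r$. Its weight function $\gamma=\alpha+\beta_1+\cdots+\beta_r$ is given by $\gamma(v)=\alpha(v)+\sum_{i:\,x_i=v}\beta_i(y_i)$ for $v\in V_H$ (so $\gamma(x)=\alpha(x)$ if $x$ is not among the $x_i$, and $\gamma(x_i)=\alpha(x_i)+\beta_i(y_i)$ when the $x_i$ are distinct), and $\gamma(y)=\beta_i(y)$ for $y\in V_i\setminus\{y_i\}$. In the formula, $\operatorname{dist}_H$ is the distance in $H$, and $M_H^{\xi_i}(x_i)$, $M_{K_i}^{\eta_i}(y_i)$ are moments computed in $H$ and $K_i$ respectively. -}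

module Defs where

open import Level using (Level)
open import Data.Nat as ℕ using (ℕ; zero; suc)
open import Data.Fin as Fin using (Fin; zero; suc; punchIn; splitAt)
open import Data.Fin.Properties using (_≟_)
open import Data.Bool using (Bool; true; false; _∧_; _∨_; if_then_else_; T)
open import Data.Sum using (_⊎_; inj₁; inj₂)
open import Data.Product using (Σ; _,_; ∃-syntax)
open import Relation.Nullary using (yes; no; ¬_)
open import Relation.Nullary.Decidable using (⌊_⌋)
open import Relation.Binary.PropositionalEquality using (_≡_; refl)
open import Algebra.Bundles using (CommutativeSemiring)

record Graph (n : ℕ) : Set where
  constructor graph
  field
    adj : Fin n → Fin n → Bool

open Graph public

IsSimple : ∀ {n} → Graph n → Set
IsSimple {n} G =
  (∀ (u v : Fin n) → adj G u v ≡ adj G v u) × (∀ (u : Fin n) → adj G u u ≡ false)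
  where open import Data.Product using (_×_)

data Walk {n : ℕ} (G : Graph n) : Fin n → Fin n → ℕ → Set where
  [] : ∀ {u} → Walk G u u 0
  _∷_ : ∀ {u w v k} → T (adj G u w) → Walk G w v k → Walk G u v (suc k)

Connected : ∀ {n} → Graph n → Set
Connected {n} G = ∀ (u v : Fin n) → ∃[ k ] Walk G u v k

anyFin : ∀ {n} → (Fin n → Bool) → Bool
anyFin {zero}  p = false
anyFin {suc n} p = p zero ∨ anyFin (λ i → p (suc i))

reach : ∀ {n} → Graph n → ℕ → Fin n → Fin n → Bool
reach G zero    u v = ⌊ u ≟ v ⌋
reach G (suc k) u v = reach G k u v ∨ anyFin (λ w → reach G k u w ∧ adj G w v)

-- Graph distance: the least k with a walk of length k from u to v
-- (searched among k = 0 .. n; in a connected graph on n vertices the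
-- distance is always < n, so the fallback value is never used).
distSearch : ∀ {n} → Graph n → Fin n → Fin n → ℕ → ℕ → ℕ
distSearch G u v zero     k = k
distSearch G u v (suc f)  k =
  if reach G k u v then k else distSearch G u v f (suc k)

dist : ∀ {n} → Graph n → Fin n → Fin n → ℕ
dist {n} G u v = distSearch G u v n 0

-- H has vertex set Fin h; K i has vertex set Fin (suc (k i)) (it is
-- nonempty as it contains y i).  The vertex set of the graft product is
-- V_H ⊎ ⋃_i (V_i ∖ {y_i}), encoded as Fin (h + Σ_i k i): the vertices of
-- K i other than y i are  punchIn (y i) b  for b : Fin (k i).

sumℕ : (r : ℕ) → (Fin r → ℕ) → ℕ
sumℕ zero    k = 0
sumℕ (suc r) k = k zero ℕ.+ sumℕ r (λ i → k (suc i))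

decodeΣ : (r : ℕ) (k : Fin r → ℕ) → Fin (sumℕ r k) → Σ (Fin r) (λ i → Fin (k i))
decodeΣ zero    k ()
decodeΣ (suc r) k x with splitAt (k zero) x
... | inj₁ a = zero , a
... | inj₂ b with decodeΣ r (λ i → k (suc i)) b
...   | i , c = suc i , c

GraftVertex : (h r : ℕ) (k : Fin r → ℕ) → Set
GraftVertex h r k = Fin h ⊎ Σ (Fin r) (λ i → Fin (k i))

view : (h r : ℕ) (k : Fin r → ℕ) → Fin (h ℕ.+ sumℕ r k) → GraftVertex h r k
view h r k x with splitAt h x
... | inj₁ a = inj₁ a
... | inj₂ b = inj₂ (decodeΣ r k b)

module _ {h r : ℕ} {k : Fin r → ℕ}
         (H : Graph h) (K : (i : Fin r) → Graph (suc (k i)))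
         (x : Fin r → Fin h) (y : (i : Fin r) → Fin (suc (k i))) where

  graftAdjV : GraftVertex h r k → GraftVertex h r k → Bool
  graftAdjV (inj₁ a) (inj₁ b) = adj H a b
  graftAdjV (inj₁ a) (inj₂ (i , b)) =
    ⌊ a ≟ x i ⌋ ∧ adj (K i) (y i) (punchIn (y i) b)
  graftAdjV (inj₂ (i , b)) (inj₁ a) =
    ⌊ a ≟ x i ⌋ ∧ adj (K i) (punchIn (y i) b) (y i)
  graftAdjV (inj₂ (i , b)) (inj₂ (j , c)) with i ≟ j
  ... | yes refl = adj (K i) (punchIn (y i) b) (punchIn (y i) c)
  ... | no _     = false

  graft : Graph (h ℕ.+ sumℕ r k)
  graft = graph (λ u v → graftAdjV (view h r k u) (view h r k v))

-- Weighted quantities, with weights in a commutative semiring R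
-- (the paper's case is R = [0,∞)).

module WithSemiring {c ℓ : Level} (R : CommutativeSemiring c ℓ) where
  open CommutativeSemiring R using (Carrier; _+_; 0#; +-rawMonoid)
  open import Algebra.Definitions.RawMonoid +-rawMonoid public using (_×_)

  ∑ : ∀ {n} → (Fin n → Carrier) → Carrier
  ∑ {zero}  f = 0#
  ∑ {suc n} f = f zero + ∑ (λ i → f (suc i))

  momentAt : ∀ {n} → Graph n → (Fin n → Carrier) → Fin n → Carrier
  momentAt G ρ u = ∑ (λ v → dist G v u × ρ v)

  moment : ∀ {n} → Graph n → (Fin n → Carrier) → Carrier
  moment G ρ = ∑ (λ u → momentAt G ρ u)

  module _ {h r : ℕ} {k : Fin r → ℕ}
           (x : Fin r → Fin h) (y : (i : Fin r) → Fin (suc (k i)))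
           (α : Fin h → Carrier) (β : (i : Fin r) → Fin (suc (k i)) → Carrier) where

    graftWeightV : GraftVertex h r k → Carrier
    graftWeightV (inj₁ a) =
      α a + ∑ (λ i → if ⌊ a ≟ x i ⌋ then β i (y i) else 0#)
    graftWeightV (inj₂ (i , b)) = β i (punchIn (y i) b)

    graftWeight : Fin (h ℕ.+ sumℕ r k) → Carrier
    graftWeight u = graftWeightV (view h r k u)

module Submission where

open import Defs
open import Level using (Level)
open import Data.Nat as ℕ using (ℕ; suc)
open import Data.Fin using (Fin)
open import Data.Bool using (if_then_else_)
open import Data.Fin.Properties using (_≟_)
open import Relation.Nullary.Decidable using (⌊_⌋)
open import Algebra.Bundles using (CommutativeSemiring)
import Data.Nat.Properties as ℕ
open import Data.Bool using (false)
open import Relation.Binary.PropositionalEquality using (_≡_)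

-- The proof rests on a distance formula.  Project the graft product G onto
-- H (a vertex of K j goes to x j) and onto each K i (every vertex outside
-- K i goes to y i); then dist_G(u, v) is the H-distance of the H-projections
-- plus the sum over i of the K i-distances of the K i-projections.  The
-- right-hand side changes by at most one along an edge of G, which gives
-- "≥"; walks through the glued vertices give "≤".  Substituting the formula
-- into M_G^γ = Σ_u Σ_v dist(v, u) γ(v) splits the moment into an H-part and
-- one part per K i, each a double sum of functions of a single projection.
-- Such sums are evaluated by counting how many vertices, and how much
-- weight, a projection collapses onto each point; collecting terms gives
-- the theorem.

module ShortestWalks where

  open import Data.Nat using (zero; _+_; _≤_; _<_; z≤n; s≤s)
  open import Data.Nat.Properties
    using (+-identityʳ; +-suc; m≤n⇒m≤1+n; m≤n⇒m<n∨m≡n; ≤-antisym; <⇒≱; ≮⇒≥; n≤0⇒n≡0)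
  open import Data.Fin using (zero; suc)
  open import Data.Fin.Properties using (_≟_; injective⇒≤)
  open import Data.Bool using (Bool; true; false; T)
  open import Data.Bool.Properties using (T-∨; T-∧)
  open import Data.Unit using (tt)
  open import Data.Product using (Σ; _×_; _,_; proj₁; proj₂; ∃-syntax)
  open import Data.Sum using (_⊎_; inj₁; inj₂)
  open import Data.Vec using (Vec; []; _∷_)
  open import Data.Vec.Relation.Unary.Any using (here; there)
  open import Data.Vec.Relation.Unary.All using (All; [])
  open import Data.Vec.Relation.Unary.AllPairs using ([]; _∷_)
  open import Data.Vec.Relation.Unary.All.Properties using (lookup⁻)
  open import Data.Vec.Relation.Unary.Unique.Propositional using (Unique)
  open import Data.Vec.Relation.Unary.Unique.Propositional.Properties using (lookup-injective)
  open import Data.Vec.Membership.Propositional.Properties using (∈-lookup)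
  open import Function using (_∘_; Equivalence)
  open import Relation.Nullary using (yes; no; ¬_; contradiction)
  open import Relation.Nullary.Decidable using (toWitness; fromWitness)
  open import Relation.Binary.PropositionalEquality using (refl; sym; trans; subst)

  open Equivalence using (to; from)

  anyFin-witness : ∀ {m} (p : Fin m → Bool) → T (anyFin p) → ∃[ w ] T (p w)
  anyFin-witness {suc m} p t with to (T-∨ {p zero}) t
  ... | inj₁ t₀ = zero , t₀
  ... | inj₂ t₁ with anyFin-witness (p ∘ suc) t₁
  ...   | w , tw = suc w , tw

  anyFin-intro : ∀ {m} (p : Fin m → Bool) w → T (p w) → T (anyFin p)
  anyFin-intro p zero    t = from (T-∨ {p zero}) (inj₁ t)
  anyFin-intro p (suc w) t = from (T-∨ {p zero}) (inj₂ (anyFin-intro (p ∘ suc) w t))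

  module _ {n : ℕ} (G : Graph n) where

    open import Data.Vec.Membership.DecPropositional (_≟_ {n}) using (_∈_; _∈?_)

    snoc : ∀ {u w v m} → Walk G u w m → T (adj G w v) → Walk G u v (suc m)
    snoc []      e = e ∷ []
    snoc (f ∷ p) e = f ∷ snoc p e

    unsnoc : ∀ {u v m} → Walk G u v (suc m) → ∃[ w ] (Walk G u w m × T (adj G w v))
    unsnoc (e ∷ []) = _ , [] , e
    unsnoc (e ∷ p@(_ ∷ _)) with unsnoc p
    ... | w , q , f = w , e ∷ q , f

    _++ʷ_ : ∀ {u w v m l} → Walk G u w m → Walk G w v l → Walk G u v (m + l)
    []      ++ʷ q = q
    (e ∷ p) ++ʷ q = e ∷ (p ++ʷ q)

    reverse : (∀ u v → adj G u v ≡ adj G v u) → ∀ {u v m} → Walk G u v m → Walk G v u m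
    reverse sym-adj []                = []
    reverse sym-adj (_∷_ {u} {w} e p) = snoc (reverse sym-adj p) (subst T (sym-adj u w) e)

    Reach : ℕ → Fin n → Fin n → Set
    Reach j u v = T (reach G j u v)

    walk⇒reach : ∀ {u v m} → Walk G u v m → Reach m u v
    walk⇒reach {m = zero}  []  = fromWitness refl
    walk⇒reach {m = suc m} p with unsnoc p
    ... | w , q , e = from (T-∨ {reach G m _ _}) (inj₂
          (anyFin-intro _ w (from (T-∧ {reach G m _ w}) (walk⇒reach q , e))))

    reach⇒walk : ∀ j {u v} → Reach j u v → ∃[ m ] (m ≤ j × Walk G u v m)
    reach⇒walk zero t with toWitness t
    ... | refl = 0 , z≤n , []
    reach⇒walk (suc j) {u} {v} t with to (T-∨ {reach G j u v}) t
    ... | inj₁ t′ with reach⇒walk j t′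
    ...   | m , m≤j , p = m , m≤n⇒m≤1+n m≤j , p
    reach⇒walk (suc j) {u} {v} t | inj₂ t′ with anyFin-witness _ t′
    ... | w , tw with to (T-∧ {reach G j u w}) tw
    ...   | t″ , e with reach⇒walk j t″
    ...     | m , m≤j , p = suc m , s≤s m≤j , snoc p e

    vertices : ∀ {u v m} → Walk G u v m → Vec (Fin n) (suc m)
    vertices {u} []      = u ∷ []
    vertices {u} (_ ∷ p) = u ∷ vertices p

    SimpleWalk : Fin n → Fin n → Set
    SimpleWalk u v = ∃[ m ] Σ (Walk G u v m) (λ p → Unique (vertices p))

    -- A simple walk visits m + 1 distinct vertices, so m < n.
    simple⇒short : ∀ {u v m} (p : Walk G u v m) → Unique (vertices p) → m < n
    simple⇒short p distinct = injective⇒≤ (lookup-injective distinct _ _)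

    suffix : ∀ {a v m} (p : Walk G a v m) → Unique (vertices p) →
             ∀ {u} → u ∈ vertices p → SimpleWalk u v
    suffix []        distinct       (here refl) = _ , [] , distinct
    suffix p@(_ ∷ _) distinct       (here refl) = _ , p , distinct
    suffix (_ ∷ p)   (_ ∷ distinct) (there u∈p) = suffix p distinct u∈p

    simplify : ∀ {u v m} → Walk G u v m → SimpleWalk u v
    simplify []                = _ , [] , ([] ∷ [])
    simplify {u} (e ∷ p) with simplify p
    ... | m , q , distinct with u ∈? vertices q
    ...   | yes u∈q = suffix q distinct u∈q
    ...   | no  u∉q = suc m , e ∷ q , (differs u∉q ∷ distinct)
      where
      differs : ∀ {l u} {vs : Vec (Fin n) l} → ¬ u ∈ vs → All (λ v → ¬ u ≡ v) vs
      differs {vs = vs} u∉vs = lookup⁻ (λ i u≡ → u∉vs (subst (_∈ vs) (sym u≡) (∈-lookup i vs)))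

    shorten : ∀ {u v m} → Walk G u v m → ∃[ l ] (l < n × Walk G u v l)
    shorten p with simplify p
    ... | l , q , distinct = l , simple⇒short q distinct , q

    NoWalkBelow : Fin n → Fin n → ℕ → Set
    NoWalkBelow u v k = ∀ {m} → m < k → ¬ Reach m u v

    search-spec : ∀ {u v} f k → NoWalkBelow u v k →
                  let d = distSearch G u v f k in
                  NoWalkBelow u v d × (Reach d u v ⊎ d ≡ k + f)
    search-spec zero k below = below , inj₂ (sym (+-identityʳ k))
    search-spec {u} {v} (suc f) k below with reach G k u v in reach-k
    ... | true  = below , inj₁ (subst T (sym reach-k) tt)
    ... | false with search-spec f (suc k) below′
      where
      below′ : NoWalkBelow u v (suc k)
      below′ (s≤s m≤k) with m≤n⇒m<n∨m≡n m≤k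
      ... | inj₁ m<k  = below m<k
      ... | inj₂ refl = subst T reach-k
    ...   | below-d , inj₁ reached = below-d , inj₁ reached
    ...   | below-d , inj₂ d≡    = below-d , inj₂ (trans d≡ (sym (+-suc k f)))

    dist-below : ∀ {u v} → NoWalkBelow u v (dist G u v)
    dist-below = proj₁ (search-spec n 0 (λ ()))

    dist-reached : ∀ {u v} → Reach (dist G u v) u v ⊎ dist G u v ≡ n
    dist-reached = proj₂ (search-spec n 0 (λ ()))

    dist-min : ∀ {u v m} → Walk G u v m → dist G u v ≤ m
    dist-min p = ≮⇒≥ (λ m<d → dist-below m<d (walk⇒reach p))

    -- ... and it is attained as soon as some walk exists (shortening that
    -- walk shows that the search does not run out of fuel).
    shortest : ∀ {u v m} → Walk G u v m → Walk G u v (dist G u v)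
    shortest {u} {v} p with dist-reached {u} {v}
    ... | inj₁ reached with reach⇒walk _ reached
    ...   | l , l≤d , q = subst (Walk G u v) (≤-antisym l≤d (dist-min q)) q
    shortest p | inj₂ d≡n with shorten p
    ... | l , l<n , q = contradiction (subst (_≤ l) d≡n (dist-min q)) (<⇒≱ l<n)

    dist-refl : ∀ u → dist G u u ≡ 0
    dist-refl u = n≤0⇒n≡0 (dist-min [])

    module _ (connected : Connected G) where

      dist-walk : ∀ u v → Walk G u v (dist G u v)
      dist-walk u v = shortest (proj₂ (connected u v))

      dist-sym : (∀ u v → adj G u v ≡ adj G v u) → ∀ u v → dist G u v ≡ dist G v u
      dist-sym sym-adj u v = ≤-antisym (dist-min (reverse sym-adj (dist-walk v u)))
                                       (dist-min (reverse sym-adj (dist-walk u v)))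

      dist-step : ∀ u {w w′} → T (adj G w w′) → dist G u w′ ≤ suc (dist G u w)
      dist-step u e = dist-min (snoc (dist-walk u _) e)

∑ℕ : ∀ {m} → (Fin m → ℕ) → ℕ
∑ℕ = WithSemiring.∑ ℕ.+-*-commutativeSemiring

module Sums {c ℓ : Level} (R : CommutativeSemiring c ℓ) where

  open import Data.Nat using (zero)
  open import Data.Fin using (zero; suc; punchIn; _↑ˡ_; _↑ʳ_)
  open import Data.Empty using (⊥-elim)
  open import Function using (_∘_)
  open import Relation.Nullary using (yes; no)
  open import Relation.Binary.PropositionalEquality as ≡ using (_≢_)
  open CommutativeSemiring R hiding (zero)
  open WithSemiring R
  open import Algebra.Properties.CommutativeSemigroup +-commutativeSemigroup using (x∙yz≈y∙xz)
  open import Algebra.Properties.Monoid.Mult +-monoid using (×-homo-+; ×-assocˡ)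
  open import Algebra.Properties.CommutativeMonoid.Mult +-commutativeMonoid using (×-distrib-+)
  import Algebra.Properties.CommutativeMonoid.Sum +-commutativeMonoid as Library
  open import Relation.Binary.Reasoning.Setoid setoid

  ∑≡sum : ∀ {m} (f : Fin m → Carrier) → ∑ f ≡ Library.sum f
  ∑≡sum {zero}  f = ≡.refl
  ∑≡sum {suc m} f = ≡.cong (f zero +_) (∑≡sum (f ∘ suc))

  ∑-cong : ∀ {m} {f g : Fin m → Carrier} → (∀ i → f i ≈ g i) → ∑ f ≈ ∑ g
  ∑-cong {f = f} {g} f≈g = begin
    ∑ f           ≡⟨ ∑≡sum f ⟩
    Library.sum f ≈⟨ Library.sum-cong-≋ f≈g ⟩
    Library.sum g ≡⟨ ≡.sym (∑≡sum g) ⟩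
    ∑ g           ∎

  ∑-+ : ∀ {m} (f g : Fin m → Carrier) → ∑ (λ i → f i + g i) ≈ ∑ f + ∑ g
  ∑-+ f g = begin
    ∑ (λ i → f i + g i)           ≡⟨ ∑≡sum (λ i → f i + g i) ⟩
    Library.sum (λ i → f i + g i) ≈⟨ Library.∑-distrib-+ f g ⟩
    Library.sum f + Library.sum g ≡⟨ ≡.sym (≡.cong₂ _+_ (∑≡sum f) (∑≡sum g)) ⟩
    ∑ f + ∑ g                     ∎

  ∑-swap : ∀ {m n} (f : Fin m → Fin n → Carrier) →
           ∑ (λ i → ∑ (λ j → f i j)) ≈ ∑ (λ j → ∑ (λ i → f i j))
  ∑-swap f = begin
    ∑ (λ i → ∑ (λ j → f i j))                     ≡⟨ ∑∑≡sumsum f ⟩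
    Library.sum (λ i → Library.sum (λ j → f i j)) ≈⟨ Library.∑-comm f ⟩
    Library.sum (λ j → Library.sum (λ i → f i j)) ≡⟨ ≡.sym (∑∑≡sumsum (λ j i → f i j)) ⟩
    ∑ (λ j → ∑ (λ i → f i j))                     ∎
    where
    ∑∑≡sumsum : ∀ {m n} (g : Fin m → Fin n → Carrier) →
                ∑ (λ i → ∑ (g i)) ≡ Library.sum (λ i → Library.sum (g i))
    ∑∑≡sumsum g = ≡.trans (∑≡sum (λ i → ∑ (g i))) (Library.sum-cong-≗ (λ i → ∑≡sum (g i)))

  ∑-remove : ∀ {m} (f : Fin (suc m) → Carrier) i → ∑ f ≈ f i + ∑ (f ∘ punchIn i)
  ∑-remove f i = begin
    ∑ f                                 ≡⟨ ∑≡sum f ⟩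
    Library.sum f                       ≈⟨ Library.sum-remove f ⟩
    f i + Library.sum (f ∘ punchIn i)   ≡⟨ ≡.cong (f i +_) (≡.sym (∑≡sum (f ∘ punchIn i))) ⟩
    f i + ∑ (f ∘ punchIn i)             ∎

  -- f with its i-th value replaced by zero, the form used in the theorem
  -- for W - B_i.
  dropAt : ∀ {m} → (Fin m → Carrier) → Fin m → Fin m → Carrier
  dropAt f i j = if ⌊ j ≟ i ⌋ then 0# else f j

  -- `_≟_` on Fin only computes on canonical arguments, hence this lemma.
  dropAt-suc : ∀ {m} (f : Fin (suc m) → Carrier) i j → dropAt (f ∘ suc) i j ≡ dropAt f (suc i) (suc j)
  dropAt-suc f i j with j ≟ i
  ... | yes _ = ≡.refl
  ... | no _  = ≡.refl

  ∑-pick : ∀ {m} (f : Fin m → Carrier) i → ∑ f ≈ f i + ∑ (dropAt f i)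
  ∑-pick {suc m} f zero    = +-congˡ (sym (+-identityˡ _))
  ∑-pick {suc m} f (suc i) = begin
    f zero + ∑ (f ∘ suc)                               ≈⟨ +-congˡ (∑-pick (f ∘ suc) i) ⟩
    f zero + (f (suc i) + ∑ (dropAt (f ∘ suc) i))      ≈⟨ x∙yz≈y∙xz _ _ _ ⟩
    f (suc i) + (f zero + ∑ (dropAt (f ∘ suc) i))
      ≈⟨ +-congˡ (+-congˡ (∑-cong (reflexive ∘ dropAt-suc f i))) ⟩
    f (suc i) + ∑ (dropAt f (suc i))                   ∎

  ∑-zero : ∀ {m} {f : Fin m → Carrier} → (∀ i → f i ≈ 0#) → ∑ f ≈ 0#
  ∑-zero {zero}  f≈0 = refl
  ∑-zero {suc m} f≈0 = trans (+-cong (f≈0 zero) (∑-zero (f≈0 ∘ suc))) (+-identityˡ 0#)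

  ∑-single : ∀ {m} {f : Fin m → Carrier} i → (∀ j → j ≢ i → f j ≈ 0#) → ∑ f ≈ f i
  ∑-single {f = f} i f≈0 = begin
    ∑ f                                               ≈⟨ ∑-pick f i ⟩
    f i + ∑ (dropAt f i)                              ≈⟨ +-congˡ (∑-zero rest≈0) ⟩
    f i + 0#                                          ≈⟨ +-identityʳ _ ⟩
    f i                                               ∎
    where
    rest≈0 : ∀ j → dropAt f i j ≈ 0#
    rest≈0 j with j ≟ i
    ... | yes _  = refl
    ... | no j≢i = f≈0 j j≢i

  ∑-double : ∀ {m} {f : Fin m → Carrier} i j → i ≢ j →
             (∀ l → l ≢ i → l ≢ j → f l ≈ 0#) → ∑ f ≈ f i + f j
  ∑-double {f = f} i j i≢j f≈0 = begin
    ∑ f                                           ≈⟨ ∑-pick f i ⟩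
    f i + ∑ (dropAt f i)                          ≈⟨ +-congˡ (∑-single j rest≈0) ⟩
    f i + dropAt f i j                            ≡⟨ ≡.cong (λ b → f i + (if b then 0# else f j)) j≟i ⟩
    f i + f j                                     ∎
    where
    j≟i : ⌊ j ≟ i ⌋ ≡ false
    j≟i with j ≟ i
    ... | yes j≡i = ⊥-elim (i≢j (≡.sym j≡i))
    ... | no _    = ≡.refl
    rest≈0 : ∀ l → l ≢ j → dropAt f i l ≈ 0#
    rest≈0 l l≢j with l ≟ i
    ... | yes _  = refl
    ... | no l≢i = f≈0 l l≢i l≢j

  ∑-const : ∀ m x → ∑ {m} (λ _ → x) ≈ m × x
  ∑-const m x = trans (reflexive (∑≡sum {m} (λ _ → x))) (Library.sum-replicate m)

  ×-zeroʳ : ∀ n → n × 0# ≈ 0#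
  ×-zeroʳ n = trans (sym (∑-const n 0#)) (∑-zero {n} (λ _ → refl))

  ×-swap : ∀ m n x → m × (n × x) ≈ n × (m × x)
  ×-swap m n x = begin
    m × (n × x)     ≈⟨ ×-assocˡ x m n ⟩
    (m ℕ.* n) × x   ≡⟨ ≡.cong (_× x) (ℕ.*-comm m n) ⟩
    (n ℕ.* m) × x   ≈⟨ sym (×-assocˡ x n m) ⟩
    n × (m × x)     ∎

  ×-∑ : ∀ {m} n (f : Fin m → Carrier) → n × ∑ f ≈ ∑ (λ i → n × f i)
  ×-∑ {zero}  n f = ×-zeroʳ n
  ×-∑ {suc m} n f = trans (×-distrib-+ (f zero) (∑ (f ∘ suc)) n) (+-congˡ (×-∑ n (f ∘ suc)))

  ∑-× : ∀ {m} (n : Fin m → ℕ) x → ∑ (λ i → n i × x) ≈ ∑ℕ n × x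
  ∑-× {zero}  n x = refl
  ∑-× {suc m} n x = trans (+-congˡ (∑-× (n ∘ suc) x)) (sym (×-homo-+ x (n zero) (∑ℕ (n ∘ suc))))

  ∑-split : ∀ m {n} (f : Fin (m ℕ.+ n) → Carrier) → ∑ f ≈ ∑ (λ i → f (i ↑ˡ n)) + ∑ (λ j → f (m ↑ʳ j))
  ∑-split zero    f = sym (+-identityˡ _)
  ∑-split (suc m) f = trans (+-congˡ (∑-split m (f ∘ suc))) (sym (+-assoc _ _ _))

  ∑-indicator : ∀ {m} (F : Fin m → Carrier → Carrier) → (∀ a → F a 0# ≈ 0#) → ∀ z w →
                ∑ (λ a → F a (if ⌊ a ≟ z ⌋ then w else 0#)) ≈ F z w
  ∑-indicator F F0 z w = trans (∑-single z vanish) at-z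
    where
    vanish : ∀ a → a ≢ z → F a (if ⌊ a ≟ z ⌋ then w else 0#) ≈ 0#
    vanish a a≢z with a ≟ z
    ... | yes a≡z = ⊥-elim (a≢z a≡z)
    ... | no  _   = F0 a
    at-z : F z (if ⌊ z ≟ z ⌋ then w else 0#) ≈ F z w
    at-z with z ≟ z
    ... | yes _   = refl
    ... | no  z≢z = ⊥-elim (z≢z ≡.refl)

  ∑-pick-≈ : ∀ {m} {f g : Fin m → Carrier} i {v} → f i ≈ v → (∀ j → j ≢ i → f j ≈ g j) →
             ∑ f ≈ v + ∑ (dropAt g i)
  ∑-pick-≈ {f = f} {g} i fᵢ≈v f≈g = trans (∑-pick f i) (+-cong fᵢ≈v (∑-cong rest≈))
    where
    rest≈ : ∀ j → dropAt f i j ≈ dropAt g i j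
    rest≈ j with j ≟ i
    ... | yes _  = refl
    ... | no j≢i = f≈g j j≢i

  ∑-dropAt-scale : ∀ {m} n (f : Fin m → Carrier) i → ∑ (dropAt (λ j → n × f j) i) ≈ n × ∑ (dropAt f i)
  ∑-dropAt-scale n f i = trans (∑-cong scaled) (sym (×-∑ n (dropAt f i)))
    where
    scaled : ∀ j → dropAt (λ j → n × f j) i j ≈ n × dropAt f i j
    scaled j with j ≟ i
    ... | yes _ = sym (×-zeroʳ n)
    ... | no  _ = refl

  ∑-dropAt-× : ∀ {m} (n : Fin m → ℕ) i v →
               ∑ (dropAt (λ j → n j × v) i) ≈ ∑ℕ (λ j → if ⌊ j ≟ i ⌋ then 0 else n j) × v
  ∑-dropAt-× n i v = trans (∑-cong termwise) (∑-× (λ j → if ⌊ j ≟ i ⌋ then 0 else n j) v)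
    where
    termwise : ∀ j → dropAt (λ j → n j × v) i j ≈ (if ⌊ j ≟ i ⌋ then 0 else n j) × v
    termwise j with j ≟ i
    ... | yes _ = refl
    ... | no  _ = refl

module NaturalSums where

  open import Data.Nat using (zero; _+_; _∸_; _≤_)
  open import Data.Nat.Properties using (+-monoˡ-≤; m+n∸m≡n)
  open import Data.Fin using (zero; suc)
  open import Relation.Nullary using (yes; no)
  open import Relation.Binary.PropositionalEquality using (_≢_; refl; sym; cong; module ≡-Reasoning)
  open import Algebra.Properties.CommutativeSemigroup ℕ.+-commutativeSemigroup using (x∙yz≈y∙xz)
  open Sums ℕ.+-*-commutativeSemiring using (∑-pick; ∑-cong; dropAt)

  ∑ℕ-step : ∀ {m} {f g : Fin m → ℕ} i → (∀ j → j ≢ i → g j ≡ f j) → g i ≤ suc (f i) →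
            ∑ℕ g ≤ suc (∑ℕ f)
  ∑ℕ-step {f = f} {g} i g≡f gᵢ≤ = begin
    ∑ℕ g                         ≡⟨ ∑-pick g i ⟩
    g i + ∑ℕ (dropAt g i)        ≡⟨ cong (g i +_) (∑-cong rest≡) ⟩
    g i + ∑ℕ (dropAt f i)        ≤⟨ +-monoˡ-≤ _ gᵢ≤ ⟩
    suc (f i + ∑ℕ (dropAt f i))  ≡⟨ cong suc (sym (∑-pick f i)) ⟩
    suc (∑ℕ f)                   ∎
    where
    open Data.Nat.Properties.≤-Reasoning
    rest≡ : ∀ j → dropAt g i j ≡ dropAt f i j
    rest≡ j with j ≟ i
    ... | yes _  = refl
    ... | no j≢i = g≡f j j≢i

  -- The count behind the factor |V| - |V_i|: if H is nonempty, the graft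
  -- product has h - 1 + m vertices outside K i, where m = Σ_{j≠i} k j.
  outside-count : ∀ {h} → Fin h → ∀ a m → h + m ≡ suc ((h + (a + m)) ∸ suc a)
  outside-count {suc h} _ a m = cong suc (sym (begin
    (h + (a + m)) ∸ a  ≡⟨ cong (_∸ a) (x∙yz≈y∙xz h a m) ⟩
    (a + (h + m)) ∸ a  ≡⟨ m+n∸m≡n a (h + m) ⟩
    h + m              ∎))
    where open ≡-Reasoning

  sumℕ≡∑ℕ : ∀ r (k : Fin r → ℕ) → sumℕ r k ≡ ∑ℕ k
  sumℕ≡∑ℕ zero    k = refl
  sumℕ≡∑ℕ (suc r) k = cong (k zero +_) (sumℕ≡∑ℕ r (λ i → k (suc i)))

module GraftVertices where

  open import Data.Nat using (zero)
  open import Data.Fin using (zero; suc; _↑ˡ_; _↑ʳ_)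
  open import Data.Fin.Properties using (splitAt-↑ˡ; splitAt-↑ʳ)
  open import Data.Product using (Σ; _,_)
  open import Data.Sum using (inj₁; inj₂)
  open import Function using (_∘_)
  open import Relation.Binary.PropositionalEquality using (refl)

  encodeΣ : (r : ℕ) (k : Fin r → ℕ) → Σ (Fin r) (Fin ∘ k) → Fin (sumℕ r k)
  encodeΣ (suc r) k (zero  , c) = c ↑ˡ sumℕ r (k ∘ suc)
  encodeΣ (suc r) k (suc i , c) = k zero ↑ʳ encodeΣ r (k ∘ suc) (i , c)

  encode : (h r : ℕ) (k : Fin r → ℕ) → GraftVertex h r k → Fin (h ℕ.+ sumℕ r k)
  encode h r k (inj₁ a) = a ↑ˡ sumℕ r k
  encode h r k (inj₂ p) = h ↑ʳ encodeΣ r k p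

  decode-encodeΣ : ∀ r k p → decodeΣ r k (encodeΣ r k p) ≡ p
  decode-encodeΣ (suc r) k (zero , c)
    rewrite splitAt-↑ˡ (k zero) c (sumℕ r (k ∘ suc)) = refl
  decode-encodeΣ (suc r) k (suc i , c)
    rewrite splitAt-↑ʳ (k zero) (sumℕ r (k ∘ suc)) (encodeΣ r (k ∘ suc) (i , c))
          | decode-encodeΣ r (k ∘ suc) (i , c) = refl

  view-encode : ∀ h r k g → view h r k (encode h r k g) ≡ g
  view-encode h r k (inj₁ a) rewrite splitAt-↑ˡ h a (sumℕ r k) = refl
  view-encode h r k (inj₂ p)
    rewrite splitAt-↑ʳ h (sumℕ r k) (encodeΣ r k p) | decode-encodeΣ r k p = refl

  module Summation {c ℓ : Level} (R : CommutativeSemiring c ℓ) where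

    open CommutativeSemiring R using (Carrier; _+_; _≈_; trans; +-cong; +-congˡ)
    open import Algebra.Properties.CommutativeSemigroup (CommutativeSemiring.+-commutativeSemigroup R)
      using (interchange)
    open WithSemiring R
    open Sums R using (∑-split; ∑-cong; ∑-+; ∑-swap)

    ∑ᴳ : ∀ {h r} {k : Fin r → ℕ} → (GraftVertex h r k → Carrier) → Carrier
    ∑ᴳ F = ∑ (λ a → F (inj₁ a)) + ∑ (λ i → ∑ (λ c → F (inj₂ (i , c))))

    ∑-encodeΣ : ∀ r k (F : Fin (sumℕ r k) → Carrier) →
                ∑ F ≈ ∑ (λ i → ∑ (λ c → F (encodeΣ r k (i , c))))
    ∑-encodeΣ zero    k F = CommutativeSemiring.refl R
    ∑-encodeΣ (suc r) k F =
      trans (∑-split (k zero) F) (+-congˡ (∑-encodeΣ r (k ∘ suc) (F ∘ (k zero ↑ʳ_))))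

    ∑-graft : ∀ h r k (F : Fin (h ℕ.+ sumℕ r k) → Carrier) → ∑ F ≈ ∑ᴳ (F ∘ encode h r k)
    ∑-graft h r k F = trans (∑-split h F) (+-congˡ (∑-encodeΣ r k (F ∘ (h ↑ʳ_))))

    ∑ᴳ-cong : ∀ {h r} {k : Fin r → ℕ} {F F′ : GraftVertex h r k → Carrier} →
              (∀ g → F g ≈ F′ g) → ∑ᴳ F ≈ ∑ᴳ F′
    ∑ᴳ-cong F≈ = +-cong (∑-cong (λ a → F≈ (inj₁ a))) (∑-cong (λ i → ∑-cong (λ c → F≈ (inj₂ (i , c)))))

    ∑ᴳ-+ : ∀ {h r} {k : Fin r → ℕ} (F F′ : GraftVertex h r k → Carrier) →
           ∑ᴳ (λ g → F g + F′ g) ≈ ∑ᴳ F + ∑ᴳ F′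
    ∑ᴳ-+ F F′ =
      trans (+-cong (∑-+ (λ a → F (inj₁ a)) (λ a → F′ (inj₁ a)))
                    (trans (∑-cong (λ i → ∑-+ (λ c → F (inj₂ (i , c))) (λ c → F′ (inj₂ (i , c)))))
                           (∑-+ (λ i → ∑ (λ c → F (inj₂ (i , c)))) (λ i → ∑ (λ c → F′ (inj₂ (i , c)))))))
            (interchange _ _ _ _)

    ∑ᴳ-swap : ∀ {h r m} {k : Fin r → ℕ} (F : Fin m → GraftVertex h r k → Carrier) →
              ∑ᴳ (λ g → ∑ (λ l → F l g)) ≈ ∑ (λ l → ∑ᴳ (F l))
    ∑ᴳ-swap F =
      trans (+-cong (∑-swap (λ a l → F l (inj₁ a)))
                    (trans (∑-cong (λ i → ∑-swap (λ c l → F l (inj₂ (i , c)))))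
                           (∑-swap (λ i l → ∑ (λ c → F l (inj₂ (i , c)))))))
            (CommutativeSemiring.sym R (∑-+ (λ l → ∑ (λ a → F l (inj₁ a)))
                                            (λ l → ∑ (λ i → ∑ (λ c → F l (inj₂ (i , c)))))))

module Projections {h r : ℕ} {k : Fin r → ℕ}
  (x : Fin r → Fin h) (y : (i : Fin r) → Fin (suc (k i))) where

  open import Data.Fin using (punchIn)
  open import Data.Fin.Properties using (_≟_)
  open import Data.Product using (_,_)
  open import Data.Sum using (inj₁; inj₂)
  open import Data.Empty using (⊥-elim)
  open import Relation.Nullary using (yes; no)
  open import Relation.Binary.PropositionalEquality using (_≢_; refl; sym)

  pin : ∀ i → Fin (k i) → Fin (suc (k i))
  pin i c = punchIn (y i) c

  πH : GraftVertex h r k → Fin h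
  πH (inj₁ a)       = a
  πH (inj₂ (i , _)) = x i

  πK : ∀ i → GraftVertex h r k → Fin (suc (k i))
  πK i (inj₁ _) = y i
  πK i (inj₂ (j , c)) with j ≟ i
  ... | yes refl = pin j c
  ... | no  _    = y i

  πK-same : ∀ i c → πK i (inj₂ (i , c)) ≡ pin i c
  πK-same i c with i ≟ i
  ... | yes refl = refl
  ... | no  i≢i  = ⊥-elim (i≢i refl)

  πK-other : ∀ {i j} c → i ≢ j → πK i (inj₂ (j , c)) ≡ y i
  πK-other {i} {j} c i≢j with j ≟ i
  ... | yes j≡i = ⊥-elim (i≢j (sym j≡i))
  ... | no  _   = refl

module GraftDistance {h r : ℕ} {k : Fin r → ℕ}
  (H : Graph h) (K : (i : Fin r) → Graph (suc (k i)))
  (x : Fin r → Fin h) (y : (i : Fin r) → Fin (suc (k i)))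
  (connectedH : Connected H)
  (looplessK : ∀ i u → adj (K i) u u ≡ false)
  (connectedK : ∀ i → Connected (K i)) where

  open import Data.Nat using (_+_; _≤_)
  open import Data.Nat.Properties
    using (+-identityʳ; +-comm; +-assoc; +-suc; +-monoˡ-≤; +-monoʳ-≤; ≤-trans; ≤-antisym; m≤m+n)
  open import Data.Fin using (punchOut)
  open import Data.Fin.Properties using (_≟_; punchIn-punchOut; punchOut-punchIn; punchInᵢ≢i)
  open import Data.Bool using (T)
  open import Data.Bool.Properties using (T-∧)
  open import Data.Product using (_,_)
  open import Data.Sum using (inj₁; inj₂)
  open import Data.Empty using (⊥-elim)
  open import Function using (Equivalence)
  open import Relation.Nullary using (yes; no)
  open import Relation.Nullary.Decidable using (toWitness; fromWitness)
  open import Relation.Binary.PropositionalEquality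
    using (_≢_; refl; sym; trans; cong; cong₂; subst; subst₂)
  open Sums ℕ.+-*-commutativeSemiring using (∑-zero; ∑-single; ∑-double)
  open ShortestWalks using (dist-min; shortest; dist-refl; dist-walk; dist-step; _++ʷ_)
  open GraftVertices using (encode; view-encode)
  open NaturalSums using (∑ℕ-step)
  open Projections x y
  open Equivalence using (from)

  G : Graph (h + sumℕ r k)
  G = graft H K x y

  V : Set
  V = GraftVertex h r k

  vertex : V → Fin (h + sumℕ r k)
  vertex = encode h r k

  dH : Fin h → Fin h → ℕ
  dH = dist H

  dK : ∀ i → Fin (suc (k i)) → Fin (suc (k i)) → ℕ
  dK i = dist (K i)

  projDist : V → V → ℕ
  projDist g g′ = dH (πH g) (πH g′) + ∑ℕ (λ i → dK i (πK i g) (πK i g′))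

  projDist-self : ∀ g → projDist g g ≡ 0
  projDist-self g = cong₂ _+_ (dist-refl H (πH g)) (∑-zero (λ i → dist-refl (K i) (πK i g)))

  step-in-block : ∀ g₀ {g g′} i → πH g ≡ πH g′ → (∀ j → j ≢ i → πK j g′ ≡ πK j g) →
                  T (adj (K i) (πK i g) (πK i g′)) → projDist g₀ g′ ≤ suc (projDist g₀ g)
  step-in-block g₀ {g} {g′} i πH≡ πK≡ e rewrite πH≡ =
    subst (projDist g₀ g′ ≤_) (+-suc (dH (πH g₀) (πH g′)) _)
      (+-monoʳ-≤ (dH (πH g₀) (πH g′))
        (∑ℕ-step i (λ j j≢i → cong (dK j (πK j g₀)) (πK≡ j j≢i))
                   (dist-step (K i) (connectedK i) (πK i g₀) e)))

  projDist-step : ∀ g₀ g g′ → T (graftAdjV H K x y g g′) → projDist g₀ g′ ≤ suc (projDist g₀ g)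
  projDist-step g₀ (inj₁ a) (inj₁ b) e =
    +-monoˡ-≤ _ (dist-step H connectedH (πH g₀) e)
  projDist-step g₀ (inj₁ a) (inj₂ (i , c)) e with Equivalence.to (T-∧ {⌊ a ≟ x i ⌋}) e
  ... | a≡xᵢ , eK with toWitness a≡xᵢ
  ... | refl = step-in-block g₀ {inj₁ (x i)} {inj₂ (i , c)} i refl (λ j j≢i → πK-other c j≢i)
                 (subst (λ t → T (adj (K i) (y i) t)) (sym (πK-same i c)) eK)
  projDist-step g₀ (inj₂ (i , c)) (inj₁ a) e with Equivalence.to (T-∧ {⌊ a ≟ x i ⌋}) e
  ... | a≡xᵢ , eK with toWitness a≡xᵢ
  ... | refl = step-in-block g₀ {inj₂ (i , c)} {inj₁ (x i)} i refl (λ j j≢i → sym (πK-other c j≢i))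
                 (subst (λ s → T (adj (K i) s (y i))) (sym (πK-same i c)) eK)
  projDist-step g₀ (inj₂ (i , c)) (inj₂ (j , c′)) e with i ≟ j
  ... | yes refl = step-in-block g₀ {inj₂ (i , c)} {inj₂ (i , c′)} i refl
                     (λ l l≢i → trans (πK-other c′ l≢i) (sym (πK-other c l≢i)))
                     (subst₂ (λ s t → T (adj (K i) s t)) (sym (πK-same i c)) (sym (πK-same i c′)) e)
  ... | no  _    = ⊥-elim e

  projDist-walk : ∀ g₀ {q p L} → Walk G q p L →
                  projDist g₀ (view h r k p) ≤ projDist g₀ (view h r k q) + L
  projDist-walk g₀ []                  = m≤m+n _ 0
  projDist-walk g₀ {q} {L = suc L} (_∷_ {w = w} e p) =
    ≤-trans (projDist-walk g₀ p)
      (subst (projDist g₀ (view h r k w) + L ≤_) (sym (+-suc (projDist g₀ (view h r k q)) L))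
        (+-monoˡ-≤ _ (projDist-step g₀ (view h r k q) (view h r k w) e)))

  -- The distance in the graft product, by cases: a path between different
  -- blocks passes through the glued vertices.
  caseDist : V → V → ℕ
  caseDist (inj₁ a)       (inj₁ b)        = dH a b
  caseDist (inj₁ a)       (inj₂ (j , c′)) = dH a (x j) + dK j (y j) (pin j c′)
  caseDist (inj₂ (i , c)) (inj₁ b)        = dK i (pin i c) (y i) + dH (x i) b
  caseDist (inj₂ (i , c)) (inj₂ (j , c′)) with i ≟ j
  ... | yes refl = dK i (pin i c) (pin i c′)
  ... | no  _    = dK i (pin i c) (y i) + dH (x i) (x j) + dK j (y j) (pin j c′)

  projDist≡caseDist : ∀ g g′ → projDist g g′ ≡ caseDist g g′
  projDist≡caseDist (inj₁ a) (inj₁ b) =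
    trans (cong (dH a b +_) (∑-zero (λ i → dist-refl (K i) (y i)))) (+-identityʳ (dH a b))
  projDist≡caseDist (inj₁ a) (inj₂ (j , c′)) =
    cong (dH a (x j) +_)
      (trans (∑-single j (λ i i≢j → trans (cong (dK i (y i)) (πK-other c′ i≢j)) (dist-refl (K i) (y i))))
             (cong (dK j (y j)) (πK-same j c′)))
  projDist≡caseDist (inj₂ (i , c)) (inj₁ b) =
    trans (cong (dH (x i) b +_)
            (trans (∑-single i (λ j j≢i → trans (cong (λ s → dK j s (y j)) (πK-other c j≢i))
                                                 (dist-refl (K j) (y j))))
                   (cong (λ s → dK i s (y i)) (πK-same i c))))
          (+-comm (dH (x i) b) _)
  projDist≡caseDist (inj₂ (i , c)) (inj₂ (j , c′)) with i ≟ j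
  ... | yes refl = cong₂ _+_ (dist-refl H (x i))
        (trans (∑-single i (λ l l≢i → trans (cong₂ (dK l) (πK-other c l≢i) (πK-other c′ l≢i))
                                             (dist-refl (K l) (y l))))
               (cong₂ (dK i) (πK-same i c) (πK-same i c′)))
  ... | no i≢j = trans (cong (dH (x i) (x j) +_) blocks)
                       (rearrange (dH (x i) (x j)) (dK i (pin i c) (y i)) (dK j (y j) (pin j c′)))
    where
    blocks : ∑ℕ (λ l → dK l (πK l (inj₂ (i , c))) (πK l (inj₂ (j , c′))))
             ≡ dK i (pin i c) (y i) + dK j (y j) (pin j c′)
    blocks = trans (∑-double i j i≢j (λ l l≢i l≢j →
                     trans (cong₂ (dK l) (πK-other c l≢i) (πK-other c′ l≢j)) (dist-refl (K l) (y l))))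
                   (cong₂ _+_ (cong₂ (dK i) (πK-same i c) (πK-other c′ i≢j))
                              (cong₂ (dK j) (πK-other c (λ j≡i → i≢j (sym j≡i))) (πK-same j c′)))
    rearrange : ∀ a b d → a + (b + d) ≡ b + a + d
    rearrange a b d = trans (sym (+-assoc a b d)) (cong (_+ d) (+-comm a b))

  edge : ∀ {g g′} → T (graftAdjV H K x y g g′) → T (adj G (vertex g) (vertex g′))
  edge {g} {g′} = subst₂ (λ u v → T (graftAdjV H K x y u v))
                         (sym (view-encode h r k g)) (sym (view-encode h r k g′))

  liftH : ∀ {a b L} → Walk H a b L → Walk G (vertex (inj₁ a)) (vertex (inj₁ b)) L
  liftH []      = []
  liftH {a} (_∷_ {w = w} e p) = edge {inj₁ a} {inj₁ w} e ∷ liftH p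

  embedK : ∀ i → Fin (suc (k i)) → V
  embedK i s with y i ≟ s
  ... | yes _   = inj₁ (x i)
  ... | no  y≢s = inj₂ (i , punchOut y≢s)

  embedK-y : ∀ i → embedK i (y i) ≡ inj₁ (x i)
  embedK-y i with y i ≟ y i
  ... | yes _   = refl
  ... | no  y≢y = ⊥-elim (y≢y refl)

  embedK-pin : ∀ i c → embedK i (pin i c) ≡ inj₂ (i , c)
  embedK-pin i c with y i ≟ pin i c
  ... | yes y≡ = ⊥-elim (punchInᵢ≢i (y i) c (sym y≡))
  ... | no  _  = cong (λ c′ → inj₂ (i , c′)) (punchOut-punchIn (y i))

  edge-in-block : ∀ i c c′ → T (adj (K i) (pin i c) (pin i c′)) →
                  T (graftAdjV H K x y (inj₂ (i , c)) (inj₂ (i , c′)))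
  edge-in-block i c c′ e with i ≟ i
  ... | yes refl = e
  ... | no  i≢i  = ⊥-elim (i≢i refl)

  edgeK : ∀ i {s t} → T (adj (K i) s t) → T (graftAdjV H K x y (embedK i s) (embedK i t))
  edgeK i {s} {t} e with y i ≟ s | y i ≟ t
  ... | yes refl | yes refl = ⊥-elim (subst T (looplessK i (y i)) e)
  ... | yes refl | no  y≢t  =
        from T-∧ (fromWitness refl , subst (λ t′ → T (adj (K i) (y i) t′)) (sym (punchIn-punchOut y≢t)) e)
  ... | no  y≢s  | yes refl =
        from T-∧ (fromWitness refl , subst (λ s′ → T (adj (K i) s′ (y i))) (sym (punchIn-punchOut y≢s)) e)
  ... | no  y≢s  | no  y≢t  = edge-in-block i _ _
        (subst₂ (λ s′ t′ → T (adj (K i) s′ t′)) (sym (punchIn-punchOut y≢s)) (sym (punchIn-punchOut y≢t)) e)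

  liftK : ∀ i {s t L} → Walk (K i) s t L → Walk G (vertex (embedK i s)) (vertex (embedK i t)) L
  liftK i []      = []
  liftK i {s} (_∷_ {w = w} e p) = edge {embedK i s} {embedK i w} (edgeK i e) ∷ liftK i p

  walkH : ∀ a b → Walk G (vertex (inj₁ a)) (vertex (inj₁ b)) (dH a b)
  walkH a b = liftH (dist-walk H connectedH a b)

  walkK : ∀ i {s t} g g′ → embedK i s ≡ g → embedK i t ≡ g′ → Walk G (vertex g) (vertex g′) (dK i s t)
  walkK i _ _ refl refl = liftK i (dist-walk (K i) (connectedK i) _ _)

  caseWalk : ∀ g g′ → Walk G (vertex g) (vertex g′) (caseDist g g′)
  caseWalk (inj₁ a) (inj₁ b) = walkH a b
  caseWalk (inj₁ a) (inj₂ (j , c′)) =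
    _++ʷ_ G (walkH a (x j)) (walkK j _ _ (embedK-y j) (embedK-pin j c′))
  caseWalk (inj₂ (i , c)) (inj₁ b) =
    _++ʷ_ G (walkK i _ _ (embedK-pin i c) (embedK-y i)) (walkH (x i) b)
  caseWalk (inj₂ (i , c)) (inj₂ (j , c′)) with i ≟ j
  ... | yes refl = walkK i _ _ (embedK-pin i c) (embedK-pin i c′)
  ... | no  _    = _++ʷ_ G (_++ʷ_ G (walkK i _ _ (embedK-pin i c) (embedK-y i)) (walkH (x i) (x j)))
                           (walkK j _ _ (embedK-y j) (embedK-pin j c′))

  graft-dist : ∀ g g′ → dist G (vertex g) (vertex g′) ≡ projDist g g′
  graft-dist g g′ = ≤-antisym upper lower
    where
    upper : dist G (vertex g) (vertex g′) ≤ projDist g g′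
    upper = subst (dist G (vertex g) (vertex g′) ≤_) (sym (projDist≡caseDist g g′))
                  (dist-min G (caseWalk g g′))
    lower : projDist g g′ ≤ dist G (vertex g) (vertex g′)
    lower with projDist-walk g (shortest G (caseWalk g g′))
    ... | bound rewrite view-encode h r k g | view-encode h r k g′ | projDist-self g = bound

module GraftSums {c ℓ : Level} (R : CommutativeSemiring c ℓ)
  {h r : ℕ} {k : Fin r → ℕ} (x : Fin r → Fin h) (y : (i : Fin r) → Fin (suc (k i))) where

  open import Data.Product using (_,_)
  open import Data.Sum using (inj₁; inj₂)
  open import Function using (_∘_)
  open CommutativeSemiring R hiding (zero)
  open import Algebra.Properties.Monoid.Mult +-monoid using (×-congʳ; ×-homo-+)
  open import Algebra.Properties.CommutativeMonoid.Mult +-commutativeMonoid using (×-distrib-+)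
  open import Algebra.Properties.CommutativeSemigroup +-commutativeSemigroup
    using (x∙yz≈xz∙y; xy∙z≈xz∙y; x∙yz≈y∙xz)
  open import Relation.Binary.PropositionalEquality as ≡ using (_≢_; cong)
  open import Relation.Binary.Reasoning.Setoid setoid
  open WithSemiring R
  open Sums R
  open NaturalSums using (outside-count; sumℕ≡∑ℕ)
  open GraftVertices.Summation R
  open Projections x y

  -- |V| - |V_i|, the number of graft vertices outside K i.
  outside : Fin r → ℕ
  outside i = (h ℕ.+ sumℕ r k) ℕ.∸ suc (k i)

  -- A vertex of K j (j ≠ i) projects to y i; all of K i is seen from H at x i.
  ∑ᴳ-πH : (F : Fin h → Carrier) → ∑ᴳ (F ∘ πH) ≈ ∑ F + ∑ (λ i → k i × F (x i))
  ∑ᴳ-πH F = +-congˡ (∑-cong (λ i → ∑-const (k i) (F (x i))))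

  ∑ᴳ-πK : ∀ i (F : Fin (suc (k i)) → Carrier) → ∑ᴳ (F ∘ πK i) ≈ ∑ F + outside i × F (y i)
  ∑ᴳ-πK i F = begin
    ∑ {h} (λ _ → Fy) + ∑ (λ j → ∑ (λ c → F (πK i (inj₂ (j , c)))))
      ≈⟨ +-congʳ (∑-const h Fy) ⟩
    h × Fy + ∑ (λ j → ∑ (λ c → F (πK i (inj₂ (j , c)))))
      ≈⟨ +-congˡ (∑-pick-≈ i (∑-cong (λ c → reflexive (cong F (πK-same i c))))
                   (λ j j≢i → trans (∑-cong (λ c → reflexive (cong F (πK-other c (j≢i ∘ ≡.sym)))))
                                    (∑-const (k j) Fy))) ⟩
    h × Fy + (∑ (F ∘ pin i) + ∑ (dropAt (λ j → k j × Fy) i))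
      ≈⟨ +-congˡ (+-congˡ (∑-dropAt-× k i Fy)) ⟩
    h × Fy + (∑ (F ∘ pin i) + others × Fy)
      ≈⟨ x∙yz≈xz∙y _ _ _ ⟩
    (h × Fy + others × Fy) + ∑ (F ∘ pin i)
      ≈⟨ +-congʳ (sym (×-homo-+ Fy h others)) ⟩
    (h ℕ.+ others) × Fy + ∑ (F ∘ pin i)
      ≡⟨ cong (λ n → n × Fy + ∑ (F ∘ pin i)) count ⟩
    (Fy + outside i × Fy) + ∑ (F ∘ pin i)
      ≈⟨ xy∙z≈xz∙y _ _ _ ⟩
    (Fy + ∑ (F ∘ pin i)) + outside i × Fy
      ≈⟨ +-congʳ (sym (∑-remove F (y i))) ⟩
    ∑ F + outside i × Fy ∎
    where
    Fy = F (y i)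
    others = ∑ℕ (λ j → if ⌊ j ≟ i ⌋ then 0 else k j)
    count : h ℕ.+ others ≡ suc (outside i)
    count = ≡.trans (outside-count (x i) (k i) others)
                    (cong (λ s → suc ((h ℕ.+ s) ℕ.∸ suc (k i))) (≡.sym split))
      where
      split : sumℕ r k ≡ k i ℕ.+ others
      split = ≡.trans (sumℕ≡∑ℕ r k) (Sums.∑-pick ℕ.+-*-commutativeSemiring k i)

  module Weighted (α : Fin h → Carrier) (β : (i : Fin r) → Fin (suc (k i)) → Carrier) where

    γ : GraftVertex h r k → Carrier
    γ = graftWeightV x y α β

    B : Fin r → Carrier
    B i = ∑ (β i)

    scaled-mass : ∀ n j → n × β j (y j) + ∑ (λ c → n × β j (pin j c)) ≈ n × B j
    scaled-mass n j = begin
      n × β j (y j) + ∑ (λ c → n × β j (pin j c)) ≈⟨ +-congˡ (sym (×-∑ n (β j ∘ pin j))) ⟩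
      n × β j (y j) + n × ∑ (β j ∘ pin j)         ≈⟨ sym (×-distrib-+ _ _ n) ⟩
      n × (β j (y j) + ∑ (β j ∘ pin j))           ≈⟨ ×-congʳ n (sym (∑-remove (β j) (y j))) ⟩
      n × B j                                     ∎

    glued-weight : ∀ (f : Fin h → ℕ) →
                   ∑ (λ a → f a × γ (inj₁ a)) ≈ ∑ (λ a → f a × α a) + ∑ (λ j → f (x j) × β j (y j))
    glued-weight f = begin
      ∑ (λ a → f a × (α a + ∑ (λ j → ind a j)))
        ≈⟨ ∑-cong (λ a → trans (×-distrib-+ _ _ (f a)) (+-congˡ (×-∑ (f a) (ind a)))) ⟩
      ∑ (λ a → f a × α a + ∑ (λ j → f a × ind a j))
        ≈⟨ ∑-+ (λ a → f a × α a) (λ a → ∑ (λ j → f a × ind a j)) ⟩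
      ∑ (λ a → f a × α a) + ∑ (λ a → ∑ (λ j → f a × ind a j))
        ≈⟨ +-congˡ (∑-swap (λ a j → f a × ind a j)) ⟩
      ∑ (λ a → f a × α a) + ∑ (λ j → ∑ (λ a → f a × ind a j))
        ≈⟨ +-congˡ (∑-cong (λ j → ∑-indicator (λ a v → f a × v) (λ a → ×-zeroʳ (f a)) (x j) (β j (y j)))) ⟩
      ∑ (λ a → f a × α a) + ∑ (λ j → f (x j) × β j (y j)) ∎
      where
      ind : Fin h → Fin r → Carrier
      ind a j = if ⌊ a ≟ x j ⌋ then β j (y j) else 0#

    ∑ᴳ-πH-weighted : (f : Fin h → ℕ) →
                     ∑ᴳ (λ g → f (πH g) × γ g) ≈ ∑ (λ a → f a × α a) + ∑ (λ j → f (x j) × B j)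
    ∑ᴳ-πH-weighted f = begin
      ∑ (λ a → f a × γ (inj₁ a)) + ∑ (λ j → ∑ (λ c → f (x j) × β j (pin j c)))
        ≈⟨ +-congʳ (glued-weight f) ⟩
      (∑ (λ a → f a × α a) + ∑ (λ j → f (x j) × β j (y j))) + ∑ (λ j → ∑ (λ c → f (x j) × β j (pin j c)))
        ≈⟨ +-assoc _ _ _ ⟩
      ∑ (λ a → f a × α a) + (∑ (λ j → f (x j) × β j (y j)) + ∑ (λ j → ∑ (λ c → f (x j) × β j (pin j c))))
        ≈⟨ +-congˡ (sym (∑-+ (λ j → f (x j) × β j (y j)) (λ j → ∑ (λ c → f (x j) × β j (pin j c))))) ⟩
      ∑ (λ a → f a × α a) + ∑ (λ j → f (x j) × β j (y j) + ∑ (λ c → f (x j) × β j (pin j c)))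
        ≈⟨ +-congˡ (∑-cong (λ j → scaled-mass (f (x j)) j)) ⟩
      ∑ (λ a → f a × α a) + ∑ (λ j → f (x j) × B j) ∎

    outside-weight : Fin r → Carrier
    outside-weight i = ∑ α + ∑ (dropAt B i)

    ∑ᴳ-πK-weighted : ∀ i (f : Fin (suc (k i)) → ℕ) →
                     ∑ᴳ (λ g → f (πK i g) × γ g) ≈ ∑ (λ b → f b × β i b) + f (y i) × outside-weight i
    ∑ᴳ-πK-weighted i f = begin
      ∑ (λ a → n × γ (inj₁ a)) + ∑ T
        ≈⟨ +-congʳ (glued-weight (λ _ → n)) ⟩
      (∑ (λ a → n × α a) + ∑ (λ j → n × β j (y j))) + ∑ T
        ≈⟨ +-assoc _ _ _ ⟩
      ∑ (λ a → n × α a) + (∑ (λ j → n × β j (y j)) + ∑ T)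
        ≈⟨ +-congˡ (sym (∑-+ (λ j → n × β j (y j)) T)) ⟩
      ∑ (λ a → n × α a) + ∑ (λ j → n × β j (y j) + T j)
        ≈⟨ +-congˡ (∑-pick-≈ i in-block (λ j j≢i → other-block j (j≢i ∘ ≡.sym))) ⟩
      ∑ (λ a → n × α a) + (∑ (λ b → f b × β i b) + ∑ (dropAt (λ j → n × B j) i))
        ≈⟨ x∙yz≈y∙xz _ _ _ ⟩
      ∑ (λ b → f b × β i b) + (∑ (λ a → n × α a) + ∑ (dropAt (λ j → n × B j) i))
        ≈⟨ +-congˡ (+-cong (sym (×-∑ n α)) (∑-dropAt-scale n B i)) ⟩
      ∑ (λ b → f b × β i b) + (n × ∑ α + n × ∑ (dropAt B i))
        ≈⟨ +-congˡ (sym (×-distrib-+ _ _ n)) ⟩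
      ∑ (λ b → f b × β i b) + n × outside-weight i ∎
      where
      n = f (y i)
      T : Fin r → Carrier
      T j = ∑ (λ c → f (πK i (inj₂ (j , c))) × β j (pin j c))
      in-block : n × β i (y i) + T i ≈ ∑ (λ b → f b × β i b)
      in-block = trans (+-congˡ (∑-cong (λ c → reflexive (cong (λ t → f t × β i (pin i c)) (πK-same i c)))))
                       (sym (∑-remove (λ b → f b × β i b) (y i)))
      other-block : ∀ j → i ≢ j → n × β j (y j) + T j ≈ n × B j
      other-block j i≢j =
        trans (+-congˡ (∑-cong (λ c → reflexive (cong (λ t → f t × β j (pin j c)) (πK-other c i≢j)))))
              (scaled-mass n j)

module Moments {c ℓ : Level} (R : CommutativeSemiring c ℓ) where

  open CommutativeSemiring R hiding (zero)
  open import Algebra.Properties.CommutativeMonoid.Mult +-commutativeMonoid using (×-distrib-+)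
  open WithSemiring R
  open Sums R

  momentAt-affine : ∀ {n} (G : Graph n) m (ρ : Fin n → Carrier) w u →
                    momentAt G (λ v → m × ρ v + w) u ≈ m × momentAt G ρ u + ∑ (λ v → dist G v u × w)
  momentAt-affine G m ρ w u =
    trans (∑-cong (λ v → trans (×-distrib-+ (m × ρ v) w (dist G v u))
                               (+-congʳ (×-swap (dist G v u) m (ρ v)))))
          (trans (∑-+ (λ v → m × (dist G v u × ρ v)) (λ v → dist G v u × w))
                 (+-congʳ (sym (×-∑ m (λ v → dist G v u × ρ v)))))

module GraftMoment {c ℓ : Level} (R : CommutativeSemiring c ℓ) {h r : ℕ} {k : Fin r → ℕ}
  (H : Graph h) (K : (i : Fin r) → Graph (suc (k i)))
  (x : Fin r → Fin h) (y : (i : Fin r) → Fin (suc (k i)))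
  (simpleH : IsSimple H) (connectedH : Connected H)
  (simpleK : ∀ i → IsSimple (K i)) (connectedK : ∀ i → Connected (K i))
  (α : Fin h → CommutativeSemiring.Carrier R)
  (β : (i : Fin r) → Fin (suc (k i)) → CommutativeSemiring.Carrier R) where

  open import Data.Product using (proj₁; proj₂)
  open import Function using (_∘_)
  open import Relation.Binary.PropositionalEquality using (cong; cong₂)
  open CommutativeSemiring R hiding (zero)
  open import Algebra.Properties.Monoid.Mult +-monoid using (×-homo-+; ×-congʳ; ×-assocˡ)
  open import Algebra.Properties.CommutativeMonoid.Mult +-commutativeMonoid using (×-distrib-+)
  open import Algebra.Solver.CommutativeMonoid +-commutativeMonoid using (solve; _⊜_; _⊕_)
  open import Relation.Binary.Reasoning.Setoid setoid
  open WithSemiring R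
  open Sums R
  open Moments R
  open GraftVertices using (view-encode)
  open GraftVertices.Summation R
  open Projections x y
  open GraftDistance H K x y connectedH (λ i → proj₂ (simpleK i)) connectedK
  open GraftSums R x y
  open Weighted α β

  dH-sym : ∀ a b → dH a b ≡ dH b a
  dH-sym = ShortestWalks.dist-sym H connectedH (proj₁ simpleH)

  dK-sym : ∀ i s t → dK i s t ≡ dK i t s
  dK-sym i = ShortestWalks.dist-sym (K i) (connectedK i) (proj₁ (simpleK i))

  H-part : Carrier
  H-part = ∑ᴳ (λ u → ∑ᴳ (λ v → dH (πH v) (πH u) × γ v))

  K-part : Fin r → Carrier
  K-part i = ∑ᴳ (λ u → ∑ᴳ (λ v → dK i (πK i v) (πK i u) × γ v))

  moment-split : moment G (graftWeight x y α β) ≈ H-part + ∑ K-part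
  moment-split = begin
    ∑ (λ u → ∑ (λ v → dist G v u × γ′ v))
      ≈⟨ ∑-graft h r k (λ u → ∑ (λ v → dist G v u × γ′ v)) ⟩
    ∑ᴳ (λ u → ∑ (λ v → dist G v (vertex u) × γ′ v))
      ≈⟨ ∑ᴳ-cong (λ u → trans (∑-graft h r k (λ v → dist G v (vertex u) × γ′ v))
                              (∑ᴳ-cong (λ v → reflexive (on-vertices v u)))) ⟩
    ∑ᴳ (λ u → ∑ᴳ (λ v → projDist v u × γ v))
      ≈⟨ ∑ᴳ-cong (λ u → trans (∑ᴳ-cong (λ v → split v u))
                              (∑ᴳ-+ (λ v → dH (πH v) (πH u) × γ v)
                                    (λ v → ∑ (λ i → dK i (πK i v) (πK i u) × γ v)))) ⟩
    ∑ᴳ (λ u → ∑ᴳ (λ v → dH (πH v) (πH u) × γ v) + ∑ᴳ (λ v → ∑ (λ i → dK i (πK i v) (πK i u) × γ v)))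
      ≈⟨ trans (∑ᴳ-+ (λ u → ∑ᴳ (λ v → dH (πH v) (πH u) × γ v))
                     (λ u → ∑ᴳ (λ v → ∑ (λ i → dK i (πK i v) (πK i u) × γ v))))
               (+-congˡ (trans (∑ᴳ-cong (λ u → ∑ᴳ-swap (λ i v → dK i (πK i v) (πK i u) × γ v)))
                               (∑ᴳ-swap (λ i u → ∑ᴳ (λ v → dK i (πK i v) (πK i u) × γ v))))) ⟩
    H-part + ∑ K-part ∎
    where
    γ′ = graftWeight x y α β
    on-vertices : ∀ v u → dist G (vertex v) (vertex u) × γ′ (vertex v) ≡ projDist v u × γ v
    on-vertices v u = cong₂ _×_ (graft-dist v u) (cong γ (view-encode h r k v))
    split : ∀ v u → projDist v u × γ v ≈
                    dH (πH v) (πH u) × γ v + ∑ (λ i → dK i (πK i v) (πK i u) × γ v)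
    split v u = trans (×-homo-+ (γ v) (dH (πH v) (πH u)) (∑ℕ (λ i → dK i (πK i v) (πK i u))))
                      (+-congˡ (sym (∑-× (λ i → dK i (πK i v) (πK i u)) (γ v))))

  H-part-eq : H-part ≈ moment H α
                       + ∑ (λ i → momentAt H (λ a → k i × α a + B i) (x i))
                       + ∑ (λ i → ∑ (λ j → (k i ℕ.* dH (x i) (x j)) × B j))
  H-part-eq = begin
    H-part
      ≈⟨ ∑ᴳ-cong (λ u → ∑ᴳ-πH-weighted (λ a → dH a (πH u))) ⟩
    ∑ᴳ (Φ ∘ πH)
      ≈⟨ ∑ᴳ-πH Φ ⟩
    ∑ Φ + ∑ (λ i → k i × Φ (x i))
      ≈⟨ +-cong (∑-+ (momentAt H α) (λ b → hubs b))
                (trans (∑-cong (λ i → ×-distrib-+ (momentAt H α (x i)) (hubs (x i)) (k i)))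
                       (∑-+ (λ i → k i × momentAt H α (x i)) (λ i → k i × hubs (x i)))) ⟩
    (moment H α + ∑ hubs) + (∑ (λ i → k i × momentAt H α (x i)) + ∑ (λ i → k i × hubs (x i)))
      ≈⟨ +-cong (+-congˡ hub-sums) (+-congˡ pair-sums) ⟩
    (moment H α + toHubs) + (∑ (λ i → k i × momentAt H α (x i)) + pairs)
      ≈⟨ solve 4 (λ m s t p → (m ⊕ s) ⊕ (t ⊕ p) ⊜ (m ⊕ (t ⊕ s)) ⊕ p) refl
                 (moment H α) toHubs (∑ (λ i → k i × momentAt H α (x i))) pairs ⟩
    moment H α + (∑ (λ i → k i × momentAt H α (x i)) + toHubs) + pairs
      ≈⟨ +-congʳ (+-congˡ (sym ξ-sum)) ⟩
    moment H α + ∑ (λ i → momentAt H (λ a → k i × α a + B i) (x i)) + pairs ∎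
    where
    hubs : Fin h → Carrier
    hubs b = ∑ (λ j → dH (x j) b × B j)
    Φ : Fin h → Carrier
    Φ b = momentAt H α b + hubs b
    toHubs pairs : Carrier
    toHubs = ∑ (λ j → ∑ (λ a → dH a (x j) × B j))
    pairs  = ∑ (λ i → ∑ (λ j → (k i ℕ.* dH (x i) (x j)) × B j))
    hub-sums : ∑ hubs ≈ toHubs
    hub-sums = trans (∑-swap (λ b j → dH (x j) b × B j))
                     (∑-cong (λ j → ∑-cong (λ b → reflexive (cong (_× B j) (dH-sym (x j) b)))))
    pair-sums : ∑ (λ i → k i × hubs (x i)) ≈ pairs
    pair-sums = ∑-cong (λ i → trans (×-∑ (k i) (λ j → dH (x j) (x i) × B j))
                  (∑-cong (λ j → trans (×-assocˡ (B j) (k i) (dH (x j) (x i)))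
                                 (reflexive (cong (λ d → (k i ℕ.* d) × B j) (dH-sym (x j) (x i)))))))
    ξ-sum : ∑ (λ i → momentAt H (λ a → k i × α a + B i) (x i))
            ≈ ∑ (λ i → k i × momentAt H α (x i)) + toHubs
    ξ-sum = trans (∑-cong (λ i → momentAt-affine H (k i) α (B i) (x i)))
                  (∑-+ (λ i → k i × momentAt H α (x i)) (λ i → ∑ (λ a → dH a (x i) × B i)))

  K-part-eq : ∀ i → K-part i ≈ moment (K i) (β i)
                               + momentAt (K i) (λ b → outside i × β i b + outside-weight i) (y i)
  K-part-eq i = begin
    K-part i
      ≈⟨ ∑ᴳ-cong (λ u → ∑ᴳ-πK-weighted i (λ b → dK i b (πK i u))) ⟩
    ∑ᴳ (Ψ ∘ πK i)
      ≈⟨ ∑ᴳ-πK i Ψ ⟩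
    ∑ Ψ + outside i × Ψ (y i)
      ≈⟨ +-cong (∑-+ (momentAt (K i) (β i)) (λ b → dK i (y i) b × W))
                (trans (×-distrib-+ (momentAt (K i) (β i) (y i)) (dK i (y i) (y i) × W) (outside i))
                       (trans (+-congˡ glued-vanishes) (+-identityʳ _))) ⟩
    (moment (K i) (β i) + ∑ (λ b → dK i (y i) b × W)) + outside i × momentAt (K i) (β i) (y i)
      ≈⟨ +-assoc _ _ _ ⟩
    moment (K i) (β i) + (∑ (λ b → dK i (y i) b × W) + outside i × momentAt (K i) (β i) (y i))
      ≈⟨ +-congˡ (trans (+-comm _ _)
                        (+-congˡ (∑-cong (λ b → reflexive (cong (_× W) (dK-sym i (y i) b)))))) ⟩
    moment (K i) (β i) + (outside i × momentAt (K i) (β i) (y i) + ∑ (λ b → dK i b (y i) × W))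
      ≈⟨ +-congˡ (sym (momentAt-affine (K i) (outside i) (β i) W (y i))) ⟩
    moment (K i) (β i) + momentAt (K i) (λ b → outside i × β i b + W) (y i) ∎
    where
    W = outside-weight i
    Ψ : Fin (suc (k i)) → Carrier
    Ψ b = momentAt (K i) (β i) b + dK i (y i) b × W
    glued-vanishes : outside i × (dK i (y i) (y i) × W) ≈ 0#
    glued-vanishes = trans (×-congʳ (outside i)
                                    (reflexive (cong (_× W) (ShortestWalks.dist-refl (K i) (y i)))))
                           (×-zeroʳ (outside i))

theorem2p1 :
  ∀ {c ℓ : Level} (R : CommutativeSemiring c ℓ) →
  let open CommutativeSemiring R in
  let open WithSemiring R in
  (h r : ℕ) (k : Fin r → ℕ)
  (H : Graph h) (K : (i : Fin r) → Graph (suc (k i))) →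
  IsSimple H → Connected H →
  (∀ i → IsSimple (K i)) → (∀ i → Connected (K i)) →
  (α : Fin h → Carrier) (β : (i : Fin r) → Fin (suc (k i)) → Carrier)
  (x : Fin r → Fin h) (y : (i : Fin r) → Fin (suc (k i))) →
  let A = ∑ α
      B = λ (i : Fin r) → ∑ (β i)
      nV = h ℕ.+ sumℕ r k
      ξ = λ (i : Fin r) (a : Fin h) → (k i × α a) + B i
      -- W - B_i, written as A + Σ_{j ≠ i} B_j
      W-B = λ (i : Fin r) → A + ∑ (λ j → if ⌊ j ≟ i ⌋ then 0# else B j)
      η = λ (i : Fin r) (b : Fin (suc (k i))) →
            ((nV ℕ.∸ suc (k i)) × β i b) + W-B i
      G = graft H K x y
      γ = graftWeight x y α β
  in
  moment G γ ≈
    (moment H α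
     + ∑ (λ i → moment (K i) (β i))
     + ∑ (λ i → momentAt H (ξ i) (x i))
     + ∑ (λ i → momentAt (K i) (η i) (y i))
     + ∑ (λ i → ∑ (λ j → (k i ℕ.* dist H (x i) (x j)) × B j)))
theorem2p1 R h r k H K simpleH connectedH simpleK connectedK α β x y = begin
  moment (graft H K x y) (graftWeight x y α β)
    ≈⟨ moment-split ⟩
  H-part + ∑ K-part
    ≈⟨ +-cong H-part-eq (trans (∑-cong K-part-eq) (∑-+ (λ i → moment (K i) (β i)) Ση)) ⟩
  (moment H α + Σξ + Σpairs) + (∑ (λ i → moment (K i) (β i)) + ∑ Ση)
    ≈⟨ solve 5 (λ m ξ p mk η → ((m ⊕ ξ) ⊕ p) ⊕ (mk ⊕ η) ⊜ (((m ⊕ mk) ⊕ ξ) ⊕ η) ⊕ p) refl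
               (moment H α) Σξ Σpairs (∑ (λ i → moment (K i) (β i))) (∑ Ση) ⟩
  moment H α + ∑ (λ i → moment (K i) (β i)) + Σξ + ∑ Ση + Σpairs ∎
  where
  open CommutativeSemiring R
  open WithSemiring R
  open Sums R using (∑-cong; ∑-+)
  open GraftMoment R H K x y simpleH connectedH simpleK connectedK α β
  open GraftSums R x y using (outside)
  open GraftSums.Weighted R x y α β using (B; outside-weight)
  open import Algebra.Solver.CommutativeMonoid +-commutativeMonoid using (solve; _⊜_; _⊕_)
  open import Relation.Binary.Reasoning.Setoid setoid
  Σξ Σpairs : Carrier
  Σξ     = ∑ (λ i → momentAt H (λ a → k i × α a + B i) (x i))
  Σpairs = ∑ (λ i → ∑ (λ j → (k i ℕ.* dist H (x i) (x j)) × B j))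
  Ση : Fin r → Carrier
  Ση i = momentAt (K i) (λ b → outside i × β i b + outside-weight i) (y i)
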